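{- For every lambda-term $t$ we have $[\![S_{ -\eta}]\!](t)=[\![S'_{ -\eta}]\!](t)$ (syntactic identity).
   Context: Lambda-terms are considered up to $\alpha$-equivalence; $\mathrm{FV}(t)$ is the set of free variables of $t$. Fix the combinators $\mathsf{S}=\lambda xyz.xz(yz)$, $\mathsf{K}=\lambda xy.x$, $\mathsf{I}=\lambda x.x$, $\mathsf{B}=\lambda xyz.x(yz)$, $\mathsf{C}=\lambda xyz.xzy$, let $\mathcal{B}=\{\mathsf{S},\mathsf{K},\mathsf{I},\mathsf{B},\mathsf{C}\}$, and let $\mathrm{CL}(\mathcal{B})$ be the set of terms built from variables and elements of $\mathcal{B}$ using only application (left-associative); equality of such terms is syntactic, combinators treated as atoms. Algorithm $S_{ -\eta}$: for a variable $x$ and $t\in\mathrm{CL}(\mathcal{B})$, $[x]t:=[x]_{S_{ -\eta}}t$ is given by the first applicable equation: $[x]t=\mathsf{K}t$ if $x\notin\mathrm{FV}(t)$; $[x]x=\mathsf{I}$; $[x](st)=\mathsf{B}s([x]t)$ if $x\notin\mathrm{FV}(s)$; $[x](st)=\mathsf{C}([x]s)t$ if $x\notin\mathrm{FV}(t)$; $[x](st)=\mathsf{S}([x]s)([x]t)$. Algorithm $S'_{ -\eta}$: $[x](st)=\mathrm{Opt}(\mathsf{S}([x]s)([x]t))$; $[x]x=\mathsf{I}$; $[x]t=\mathsf{K}t$ otherwise (for $t$ a variable other than $x$ or a constant), earlier equations taking precedence, where $\mathrm{Opt}$ is given by the first applicable clause: $\mathrm{Opt}(\mathsf{S}(\mathsf{K}s)(\mathsf{K}t))=\mathsf{K}(st)$;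 $\mathrm{Opt}(\mathsf{S}(\mathsf{K}s)t)=\mathsf{B}st$; $\mathrm{Opt}(\mathsf{S}s(\mathsf{K}t))=\mathsf{C}st$; $\mathrm{Opt}(\mathsf{S}st)=\mathsf{S}st$. For an abstraction algorithm $A$ the induced translation $[\![A]\!]$ from lambda-terms to $\mathrm{CL}(\mathcal{B})$ is defined by $[\![A]\!](x)=x$, $[\![A]\!](st)=[\![A]\!](s)\,[\![A]\!](t)$, $[\![A]\!](\lambda x.t)=[x]_A([\![A]\!](t))$. -}

module Defs where

open import Data.Nat using (ℕ)
open import Data.Nat.Properties using (_≟_)
open import Data.Bool using (Bool; true; false; _∨_; if_then_else_)
open import Relation.Nullary.Decidable using (⌊_⌋)

Var : Set
Var = ℕ

-- The translations below produce
-- binder-free terms, so they are invariant under α-conversion; hence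
-- quantifying over named representatives is the same as quantifying
-- over α-classes.
data Λ : Set where
  var : Var → Λ
  app : Λ → Λ → Λ
  lam : Var → Λ → Λ

data Comb : Set where
  S K I B C : Comb

data CL : Set where
  v   : Var → CL
  c   : Comb → CL
  _·_ : CL → CL → CL

infixl 9 _·_

occurs : Var → CL → Bool
occurs x (v y)   = ⌊ x ≟ y ⌋
occurs x (c _)   = false
occurs x (s · t) = occurs x s ∨ occurs x t

absS : Var → CL → CL
absS x t with occurs x t
... | false = c K · t
absS x (v y)   | true = c I          -- occurs forces y = x: [x]x = I
absS x (c k)   | true = c K · c k   -- impossible case (x ∉ FV(k))
absS x (s · t) | true with occurs x s | occurs x t
... | false | _     = c B · s · absS x t
... | true  | false = c C · absS x s · t
... | true  | true  = c S · absS x s · absS x t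

opt : CL → CL
opt (c S · (c K · s) · (c K · t)) = c K · (s · t)
opt (c S · (c K · s) · t)         = c B · s · t
opt (c S · s · (c K · t))         = c C · s · t
opt u                             = u

absS' : Var → CL → CL
absS' x (s · t) = opt (c S · absS' x s · absS' x t)
absS' x (v y)   = if ⌊ x ≟ y ⌋ then c I else c K · v y
absS' x (c k)   = c K · c k

translate : (Var → CL → CL) → Λ → CL
translate A (var x)   = v x
translate A (app s t) = translate A s · translate A t
translate A (lam x t) = A x (translate A t)

-- When x ∉ FV(t), S'_{-η} rebuilds K t bottom-up through the first clause of
-- Opt.  When x ∈ FV(t), the result of S_{-η} is never of the form K u, so the
-- clauses of Opt on S ([x]s) ([x]t) select exactly the equation of S_{-η}
-- chosen by which of s, t contain x.
module Submission where

open import Defs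
open import Relation.Binary.PropositionalEquality using (_≡_; refl; cong; cong₂; sym; trans)
open import Data.Bool using (true; false)
open import Data.Nat.Properties using (_≟_)
open import Relation.Nullary using (yes; no)

data NonConstant : CL → Set where
  I-nonConstant : NonConstant (c I)
  B-nonConstant : ∀ a b → NonConstant (c B · a · b)
  C-nonConstant : ∀ a b → NonConstant (c C · a · b)
  S-nonConstant : ∀ a b → NonConstant (c S · a · b)

opt-B : ∀ s u → NonConstant u → opt (c S · (c K · s) · u) ≡ c B · s · u
opt-B s _ I-nonConstant       = refl
opt-B s _ (B-nonConstant _ _) = refl
opt-B s _ (C-nonConstant _ _) = refl
opt-B s _ (S-nonConstant _ _) = refl

opt-C : ∀ u t → NonConstant u → opt (c S · u · (c K · t)) ≡ c C · u · t
opt-C _ t I-nonConstant       = refl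
opt-C _ t (B-nonConstant _ _) = refl
opt-C _ t (C-nonConstant _ _) = refl
opt-C _ t (S-nonConstant _ _) = refl

opt-S : ∀ u w → NonConstant u → NonConstant w → opt (c S · u · w) ≡ c S · u · w
opt-S _ _ I-nonConstant       I-nonConstant       = refl
opt-S _ _ I-nonConstant       (B-nonConstant _ _) = refl
opt-S _ _ I-nonConstant       (C-nonConstant _ _) = refl
opt-S _ _ I-nonConstant       (S-nonConstant _ _) = refl
opt-S _ _ (B-nonConstant _ _) I-nonConstant       = refl
opt-S _ _ (B-nonConstant _ _) (B-nonConstant _ _) = refl
opt-S _ _ (B-nonConstant _ _) (C-nonConstant _ _) = refl
opt-S _ _ (B-nonConstant _ _) (S-nonConstant _ _) = refl
opt-S _ _ (C-nonConstant _ _) I-nonConstant       = refl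
opt-S _ _ (C-nonConstant _ _) (B-nonConstant _ _) = refl
opt-S _ _ (C-nonConstant _ _) (C-nonConstant _ _) = refl
opt-S _ _ (C-nonConstant _ _) (S-nonConstant _ _) = refl
opt-S _ _ (S-nonConstant _ _) I-nonConstant       = refl
opt-S _ _ (S-nonConstant _ _) (B-nonConstant _ _) = refl
opt-S _ _ (S-nonConstant _ _) (C-nonConstant _ _) = refl
opt-S _ _ (S-nonConstant _ _) (S-nonConstant _ _) = refl

absS'-fresh : ∀ x t → occurs x t ≡ false → absS' x t ≡ c K · t
absS'-fresh x (v y) x∉t with x ≟ y
... | no _ = refl
absS'-fresh x (v y) () | yes _
absS'-fresh x (c k) x∉t = refl
absS'-fresh x (s · t) x∉st with occurs x s in x∉s | occurs x t in x∉t
absS'-fresh x (s · t) x∉st | false | false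
  rewrite absS'-fresh x s x∉s | absS'-fresh x t x∉t = refl
absS'-fresh x (s · t) () | false | true
absS'-fresh x (s · t) () | true  | _

absS-nonConstant : ∀ x t → occurs x t ≡ true → NonConstant (absS x t)
absS-nonConstant x t x∈t with occurs x t in occ
absS-nonConstant x t () | false
absS-nonConstant x (v y) _ | true = I-nonConstant
absS-nonConstant x (c k) _ | true with () <- occ
absS-nonConstant x (s · t) _ | true with occurs x s | occurs x t
... | false | _     = B-nonConstant _ _
... | true  | false = C-nonConstant _ _
... | true  | true  = S-nonConstant _ _

absS≡absS' : ∀ x t → absS x t ≡ absS' x t
absS≡absS' x t with occurs x t in occ
... | false = sym (absS'-fresh x t occ)
absS≡absS' x (v y) | true with x ≟ y
... | yes _ = refl
... | no _ with () <- occ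
absS≡absS' x (c k) | true with () <- occ
absS≡absS' x (s · t) | true with occurs x s in occ-s | occurs x t in occ-t
... | false | false with () <- occ
... | false | true
  rewrite absS'-fresh x s occ-s | sym (absS≡absS' x t) =
    sym (opt-B s (absS x t) (absS-nonConstant x t occ-t))
... | true | false
  rewrite absS'-fresh x t occ-t | sym (absS≡absS' x s) =
    sym (opt-C (absS x s) t (absS-nonConstant x s occ-s))
... | true | true
  rewrite sym (absS≡absS' x s) | sym (absS≡absS' x t) =
    sym (opt-S _ _ (absS-nonConstant x s occ-s) (absS-nonConstant x t occ-t))

mainTheorem7 : (t : Λ) → translate absS t ≡ translate absS' t
mainTheorem7 (var x)   = refl
mainTheorem7 (app s t) = cong₂ _·_ (mainTheorem7 s) (mainTheorem7 t)
mainTheorem7 (lam x t) =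
  trans (cong (absS x) (mainTheorem7 t)) (absS≡absS' x (translate absS' t))
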